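{- Let $k\geq 2$ and let $G$ be a finite $k$-rotational group. Then every characteristic subgroup $H\neq 1$ of $G$ is $k$-rotational.
   Context: For a finite group $X$ let $X^*=X\setminus\{1\}$. A partition of a set is a collection of non-empty pairwise disjoint subsets whose union is the set. $X$ is $k$-rotational if there exist $\sigma\in\mathrm{Aut}(X)$ and $S\subseteq X^*$ with $S^{ -1}=S$ such that $\{S,S^{\sigma},\dots,S^{\sigma^{k-1}}\}$ is a partition of $X^*$ (the $k$ sets pairwise disjoint and non-empty). A characteristic subgroup is one fixed by every automorphism. -}

module Defs where

open import Level using (0ℓ)
open import Data.Unit using (⊤)
open import Data.Nat using (ℕ; zero; suc)
open import Data.Fin using (Fin; toℕ)
open import Data.Product using (Σ; ∃; ∃-syntax; _×_; _,_)
open import Relation.Binary.PropositionalEquality using (_≡_)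
open import Relation.Nullary using (¬_)
open import Algebra.Structures using (IsGroup)
open import Function.Definitions using (Bijective)

record FinGroup : Set₁ where
  field
    n       : ℕ
    _∙_     : Fin n → Fin n → Fin n
    ε       : Fin n
    _⁻¹     : Fin n → Fin n
    isGroup : IsGroup _≡_ _∙_ ε _⁻¹

Pred : ℕ → Set₁
Pred n = Fin n → Set

iter : {A : Set} → (A → A) → ℕ → A → A
iter f zero    x = x
iter f (suc i) x = f (iter f i x)

module _ (G : FinGroup) where
  open FinGroup G

  IsSubgroup : Pred n → Set
  IsSubgroup H = H ε × (∀ x y → H x → H y → H (x ∙ y)) × (∀ x → H x → H (x ⁻¹))

  IsAut : (Fin n → Fin n) → Set
  IsAut σ = Bijective _≡_ _≡_ σ × (∀ x y → σ (x ∙ y) ≡ σ x ∙ σ y)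

  IsCharacteristic : Pred n → Set
  IsCharacteristic H = IsSubgroup H ×
    (∀ σ → IsAut σ → (∀ x → H x → H (σ x)) × (∀ y → H y → ∃[ x ] (H x × σ x ≡ y)))

  IsAutOn : Pred n → (Fin n → Fin n) → Set
  IsAutOn H σ =
    (∀ x → H x → H (σ x)) ×
    (∀ x y → H x → H y → σ x ≡ σ y → x ≡ y) ×
    (∀ y → H y → ∃[ x ] (H x × σ x ≡ y)) ×
    (∀ x y → H x → H y → σ (x ∙ y) ≡ σ x ∙ σ y)

  Img : (Fin n → Fin n) → ℕ → Pred n → Pred n
  Img σ i S x = ∃[ s ] (S s × iter σ i s ≡ x)

  -- The subgroup H (viewed as a group) is k-rotational: there are an automorphism
  -- σ of H and S ⊆ H* with S⁻¹ = S such that S, S^σ, …, S^{σ^{k-1}} is a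
  -- partition of H* = H ∖ {1} (pairwise disjoint, non-empty, covering H*).
  RotationalOn : Pred n → ℕ → Set₁
  RotationalOn H k = Σ (Fin n → Fin n) λ σ → Σ (Pred n) λ S →
    IsAutOn H σ ×
    (∀ x → S x → H x × ¬ (x ≡ ε)) ×
    (∀ x → S x → S (x ⁻¹)) ×
    (∀ (i : Fin k) → ∃[ x ] Img σ (toℕ i) S x) ×
    (∀ (i j : Fin k) → ¬ (i ≡ j) → ∀ x → Img σ (toℕ i) S x → ¬ Img σ (toℕ j) S x) ×
    (∀ x → H x → ¬ (x ≡ ε) → ∃[ i ] Img σ (toℕ {k} i) S x)

  Rotational : ℕ → Set₁
  Rotational k = RotationalOn (λ _ → ⊤) k

{-# OPTIONS --safe #-}
module Submission where

-- Keep the automorphism σ of G and take T = S ∩ H. A characteristic subgroup is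
-- mapped onto itself by σ, hence membership in H can be pulled back along every
-- power of σ, so H ∩ S^{σ^i} = T^{σ^i}: intersecting the partition of G* with H
-- gives a partition of H*. One element of H* lies in some T^{σ^i}, so T is
-- nonempty and so are all its images.

open import Defs
open import Data.Nat using (ℕ; zero; suc; _≥_)
open import Data.Fin using (Fin; toℕ)
open import Data.Unit using (⊤; tt)
open import Data.Product using (∃-syntax; _×_; _,_; proj₁; proj₂)
open import Function.Definitions using (Injective)
open import Relation.Binary.PropositionalEquality using (_≡_; refl; sym; subst)
open import Relation.Nullary using (¬_)

iter-reflects : {A : Set} {f : A → A} (P : A → Set) →
  (∀ x → P (f x) → P x) → ∀ i x → P (iter f i x) → P x
iter-reflects P reflects zero    x p = p
iter-reflects {f = f} P reflects (suc i) x p =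
  iter-reflects P reflects i x (reflects (iter f i x) p)

module _ (G : FinGroup) where
  open FinGroup G

  IsInvariant : Pred n → (Fin n → Fin n) → Set
  IsInvariant H σ = (∀ x → H x → H (σ x)) × (∀ y → H y → ∃[ x ] (H x × σ x ≡ y))

  isAut-of-autOn-carrier : ∀ {σ} → IsAutOn G (λ _ → ⊤) σ → IsAut G σ
  isAut-of-autOn-carrier {σ} (_ , inj , onto , hom) =
    ((λ {x} {y} → inj x y tt tt) , surjective) , λ x y → hom x y tt tt
    where
    surjective : ∀ y → ∃[ x ] (∀ {z} → z ≡ x → σ z ≡ y)
    surjective y with onto y tt
    ... | x , _ , σx≡y = x , λ { refl → σx≡y }

  autOn-of-invariant : ∀ {H σ} → IsAut G σ → IsInvariant H σ → IsAutOn G H σ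
  autOn-of-invariant ((inj , _) , hom) (into , onto) =
    into , (λ _ _ _ _ → inj) , onto , λ x y _ _ → hom x y

  invariant-reflects : ∀ {H σ} → Injective _≡_ _≡_ σ → IsInvariant H σ →
    ∀ x → H (σ x) → H x
  invariant-reflects {H} {σ} inj (_ , onto) x Hσx with onto (σ x) Hσx
  ... | y , Hy , σy≡σx = subst H (inj σy≡σx) Hy

  Img-∩-reflecting : ∀ {H : Pred n} {σ S} → (∀ x → H (σ x) → H x) →
    ∀ i x → Img G σ i S x → H x → Img G σ i (λ s → S s × H s) x
  Img-∩-reflecting {H} reflects i x (s , Ss , σⁱs≡x) Hx =
    s , (Ss , iter-reflects H reflects i s (subst H (sym σⁱs≡x) Hx)) , σⁱs≡x

  invariantSubgroup-rotational : ∀ {k H} (rot : Rotational G k) →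
    IsSubgroup G H → IsInvariant H (proj₁ rot) →
    ∃[ x ] (H x × ¬ (x ≡ ε)) → RotationalOn G H k
  invariantSubgroup-rotational {k} {H}
    (σ , S , autOn , S⊆G* , S⁻¹ , _ , disjoint , cover) (_ , _ , H⁻¹) invariant
    (h , Hh , h≢ε) =
    σ , T , autOn-of-invariant aut invariant ,
    (λ x (Sx , Hx) → Hx , proj₂ (S⊆G* x Sx)) ,
    (λ x (Sx , Hx) → S⁻¹ x Sx , H⁻¹ x Hx) ,
    nonempty , disjoint-T , cover-T
    where
    aut : IsAut G σ
    aut = isAut-of-autOn-carrier autOn

    T : Pred n
    T s = S s × H s

    cover-T : ∀ x → H x → ¬ (x ≡ ε) → ∃[ i ] Img G σ (toℕ {k} i) T x
    cover-T x Hx x≢ε with cover x tt x≢ε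
    ... | i , x∈Sσⁱ =
      i , Img-∩-reflecting (invariant-reflects (proj₁ (proj₁ aut)) invariant)
            (toℕ i) x x∈Sσⁱ Hx

    nonempty : ∀ (i : Fin k) → ∃[ x ] Img G σ (toℕ i) T x
    nonempty i with cover-T h Hh h≢ε
    ... | _ , t , Tt , _ = iter σ (toℕ i) t , t , Tt , refl

    disjoint-T : ∀ (i j : Fin k) → ¬ (i ≡ j) → ∀ x →
      Img G σ (toℕ i) T x → ¬ Img G σ (toℕ j) T x
    disjoint-T i j i≢j x (s , (Ss , _) , σⁱs≡x) (s′ , (Ss′ , _) , σʲs′≡x) =
      disjoint i j i≢j x (s , Ss , σⁱs≡x) (s′ , Ss′ , σʲs′≡x)

lemma3p4 : (k : ℕ) → k ≥ 2 → (G : FinGroup) → Rotational G k →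
    (H : Fin (FinGroup.n G) → Set) → IsCharacteristic G H →
    (∃[ x ] (H x × ¬ (x ≡ FinGroup.ε G))) →
    RotationalOn G H k
lemma3p4 k _ G rot@(σ , _ , autOn , _) H (subgroup , characteristic) nontrivial =
  invariantSubgroup-rotational G rot subgroup
    (characteristic σ (isAut-of-autOn-carrier G autOn)) nontrivial
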